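{- Let $p$ be a prime and $1\leq \ell <p$. For any $u\in\mathbb{F}_p$, \[\# S_\ell(u) = \binom{p}{\ell}/p = S_\ell^* + S_{\ell-1}^* = S_\ell^{*0} + S_{\ell-1}^{*0}.\]
   Context: For $u\in\mathbb{F}_p$: $S_\ell(u)=\{S\subseteq \mathbb{F}_p \mid \#S=\ell,~\sum_{s\in S} s = u\}$ and $S_\ell^*(u)=\{S\subseteq \mathbb{F}_p^* \mid \#S=\ell,~\sum_{s\in S} s = u\}$, where $\mathbb{F}_p^*=\mathbb{F}_p\setminus\{0\}$. Write $S_\ell^{*0}:=\#S_\ell^*(0)$ and $S_\ell^*:=\#S_\ell^*(1)$ (the value $\#S_\ell^*(u)$ is the same for every $u\in\mathbb{F}_p^*$). -}

module Defs where

open import Data.Nat using (ℕ; zero; suc; _+_; _%_; NonZero; _≟_)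
open import Data.Bool using (Bool; true; false)
open import Data.Fin using (Fin; toℕ; fromℕ<; zero; suc)
open import Data.Fin.Subset using (Subset; ∣_∣; _∈_)
open import Data.Vec using (Vec; []; _∷_)
open import Data.List using (List; []; _∷_; map; _++_; length; filter)
open import Data.Product using (_×_)
open import Relation.Nullary using (¬_)
open import Relation.Nullary.Decidable using (_×-dec_; ¬?)
open import Data.Fin.Subset.Properties using (_∈?_)
open import Relation.Binary.PropositionalEquality using (_≡_)

-- F_p is modelled as Fin p (elements 0..p-1), subsets of F_p as Subset p.

allSubsets : (n : ℕ) → List (Subset n)
allSubsets zero = [] ∷ []
allSubsets (suc n) = map (true ∷_) (allSubsets n) ++ map (false ∷_) (allSubsets n)

elemSum : ∀ {n} → Subset n → ℕ
elemSum {n} s = go s (λ i → toℕ i)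
  where
  go : ∀ {m} → Subset m → (Fin m → ℕ) → ℕ
  go [] f = 0
  go (true ∷ s) f = f zero + go s (λ i → f (suc i))
  go (false ∷ s) f = go s (λ i → f (suc i))

sumModP : (p : ℕ) .{{_ : NonZero p}} → Subset p → ℕ
sumModP p s = elemSum s % p

Scount : (p : ℕ) .{{_ : NonZero p}} → ℕ → Fin p → ℕ
Scount p ℓ u =
  length (filter (λ s → (∣ s ∣ ≟ ℓ) ×-dec (sumModP p s ≟ toℕ u)) (allSubsets p))

-- #S*_ℓ(u) : ℓ-element subsets of F_p^* = F_p \ {0} whose elements sum to u
-- (stated for p = suc q so that 0 = zero : Fin p).
Sstar : (q : ℕ) → ℕ → Fin (suc q) → ℕ
Sstar q ℓ u =
  length (filter (λ s → (¬? (zero ∈? s)) ×-dec ((∣ s ∣ ≟ ℓ) ×-dec (sumModP (suc q) s ≟ toℕ u)))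
                 (allSubsets (suc q)))

{-# OPTIONS --safe #-}
-- Translating a subset of ℤ/p by 1 adds its size ℓ to its sum. Hence the number of ℓ-subsets
-- with sum v has period ℓ in v as well as period p, and as ℓ is prime to p, Bézout makes it
-- constant; summing over v gives p · #S_ℓ(u) = C(p,ℓ). An ℓ-subset either avoids 0 or is
-- {0} ∪ T with T an (ℓ-1)-subset of F_p^* of the same sum, so #S_ℓ(v) = #S*_ℓ(v) + #S*_{ℓ-1}(v),
-- and by constancy v may be taken to be 1 or 0.
module Submission where

open import Data.Bool using (true; false; if_then_else_)
open import Data.Fin using (Fin; zero; suc; toℕ; inject₁; fromℕ)
open import Data.Fin.Properties using (toℕ-inject₁; toℕ-fromℕ; toℕ<n)
open import Data.Fin.Subset using (Subset; ∣_∣)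
open import Data.List using (List; []; _∷_; _++_; map; length; filter)
open import Data.List.Properties using (map-++; map-∘)
open import Data.Nat using (ℕ; zero; suc; _+_; _*_; _∸_; _≤_; _<_; _%_; _≟_; s≤s)
open import Data.Nat.Combinatorics using (_C_; nCk+nC[k+1]≡[n+1]C[k+1])
open import Data.Nat.Coprimality using (Coprime; coprime-Bézout; prime⇒coprime)
open import Data.Nat.DivMod using (%-distribˡ-+; [m+n]%n≡m%n; [m+kn]%n≡m%n; m<n⇒m%n≡m; m%n<n)
open import Data.Nat.GCD using (module Bézout)
open import Data.Nat.ListAction using (sum)
open import Data.Nat.ListAction.Properties using (sum-++)
open import Data.Nat.Primality using (Prime)
open import Data.Nat.Properties using (+-assoc; +-comm; +-identityʳ; +-suc; *-comm; *-zeroʳ; +-commutativeSemigroup)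
open import Algebra.Properties.CommutativeSemigroup +-commutativeSemigroup using () renaming (interchange to +-interchange)
open import Data.Nat.Solver using (module +-*-Solver)
open import Data.Product using (_×_; _,_)
open import Data.Vec using ([]; _∷_; _∷ʳ_)
open import Function using (_∘_; const)
open import Level using (Level)
open import Function.Bundles using (_⇔_; mk⇔)
open import Relation.Nullary using (Dec; yes; no; does)
open import Relation.Nullary.Decidable using (_×-dec_; does-⇔)
open import Relation.Unary using (Pred; Decidable)
open import Relation.Binary.PropositionalEquality
open ≡-Reasoning

open import Defs

open +-*-Solver using (solve; _:+_; _:*_; _:=_; con)

𝟙 : {a : Level} {A : Set a} → Dec A → ℕ
𝟙 a? = if does a? then 1 else 0

𝟙-cong-⇔ : {a b : Level} {A : Set a} {B : Set b} → A ⇔ B → (a? : Dec A) (b? : Dec B) → 𝟙 a? ≡ 𝟙 b?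
𝟙-cong-⇔ A⇔B a? b? = cong (if_then 1 else 0) (does-⇔ A⇔B a? b?)

length-filter≡sum-𝟙 : {a p : Level} {A : Set a} {P : Pred A p} (P? : Decidable P) (xs : List A) →
  length (filter P? xs) ≡ sum (map (𝟙 ∘ P?) xs)
length-filter≡sum-𝟙 P? []       = refl
length-filter≡sum-𝟙 P? (x ∷ xs) with does (P? x)
... | true  = cong suc (length-filter≡sum-𝟙 P? xs)
... | false = length-filter≡sum-𝟙 P? xs

sumFin : (n : ℕ) → (Fin n → ℕ) → ℕ
sumFin zero    f = 0
sumFin (suc n) f = f zero + sumFin n (f ∘ suc)

sumFin-cong : ∀ n {f g : Fin n → ℕ} → (∀ i → f i ≡ g i) → sumFin n f ≡ sumFin n g
sumFin-cong zero    f≗g = refl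
sumFin-cong (suc n) f≗g = cong₂ _+_ (f≗g zero) (sumFin-cong n (f≗g ∘ suc))

sumFin-const : ∀ n {f : Fin n → ℕ} {c} → (∀ i → f i ≡ c) → sumFin n f ≡ n * c
sumFin-const zero    f≡c = refl
sumFin-const (suc n) f≡c = cong₂ _+_ (f≡c zero) (sumFin-const n (f≡c ∘ suc))

sumFin-zero : ∀ n {f : Fin n → ℕ} → (∀ i → f i ≡ 0) → sumFin n f ≡ 0
sumFin-zero n f≡0 = trans (sumFin-const n f≡0) (*-zeroʳ n)

sumFin-𝟙-≡-toℕ : ∀ {m n} → m < n → sumFin n (λ i → 𝟙 (m ≟ toℕ i)) ≡ 1
sumFin-𝟙-≡-toℕ {zero}  {suc n} _         = cong suc (sumFin-zero n (λ _ → refl))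
sumFin-𝟙-≡-toℕ {suc m} {suc n} (s≤s m<n) = sumFin-𝟙-≡-toℕ m<n

sumFin-𝟙-×-dec-≡-toℕ : {a : Level} {A : Set a} (a? : Dec A) {m n : ℕ} → m < n →
  sumFin n (λ i → 𝟙 (a? ×-dec (m ≟ toℕ i))) ≡ 𝟙 a?
sumFin-𝟙-×-dec-≡-toℕ (yes _) m<n = sumFin-𝟙-≡-toℕ m<n
sumFin-𝟙-×-dec-≡-toℕ (no _) {n = n} _ = sumFin-zero n (λ _ → refl)

sumSubsets : (n : ℕ) → (Subset n → ℕ) → ℕ
sumSubsets zero    f = f []
sumSubsets (suc n) f = sumSubsets n (f ∘ (true ∷_)) + sumSubsets n (f ∘ (false ∷_))

sum-map-allSubsets : ∀ n (f : Subset n → ℕ) → sum (map f (allSubsets n)) ≡ sumSubsets n f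
sum-map-allSubsets zero    f = +-identityʳ (f [])
sum-map-allSubsets (suc n) f = begin
  sum (map f (map (true ∷_) xs ++ map (false ∷_) xs))
    ≡⟨ cong sum (map-++ f (map (true ∷_) xs) (map (false ∷_) xs)) ⟩
  sum (map f (map (true ∷_) xs) ++ map f (map (false ∷_) xs))
    ≡⟨ sum-++ (map f (map (true ∷_) xs)) (map f (map (false ∷_) xs)) ⟩
  sum (map f (map (true ∷_) xs)) + sum (map f (map (false ∷_) xs))
    ≡⟨ cong₂ _+_ (half true) (half false) ⟩
  sumSubsets n (f ∘ (true ∷_)) + sumSubsets n (f ∘ (false ∷_)) ∎
  where
  xs = allSubsets n
  half : ∀ b → sum (map f (map (b ∷_) xs)) ≡ sumSubsets n (f ∘ (b ∷_))
  half b = trans (cong sum (sym (map-∘ xs))) (sum-map-allSubsets n (f ∘ (b ∷_)))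

length-filter-allSubsets : ∀ n {p} {P : Pred (Subset n) p} (P? : Decidable P) →
  length (filter P? (allSubsets n)) ≡ sumSubsets n (𝟙 ∘ P?)
length-filter-allSubsets n P? =
  trans (length-filter≡sum-𝟙 P? (allSubsets n)) (sum-map-allSubsets n (𝟙 ∘ P?))

sumSubsets-cong : ∀ n {f g : Subset n → ℕ} → (∀ s → f s ≡ g s) → sumSubsets n f ≡ sumSubsets n g
sumSubsets-cong zero    f≗g = f≗g []
sumSubsets-cong (suc n) f≗g =
  cong₂ _+_ (sumSubsets-cong n (f≗g ∘ (true ∷_))) (sumSubsets-cong n (f≗g ∘ (false ∷_)))

sumSubsets-zero : ∀ n → sumSubsets n (const 0) ≡ 0
sumSubsets-zero zero    = refl
sumSubsets-zero (suc n) = cong₂ _+_ (sumSubsets-zero n) (sumSubsets-zero n)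

sumSubsets-distrib-+ : ∀ n (f g : Subset n → ℕ) →
  sumSubsets n (λ s → f s + g s) ≡ sumSubsets n f + sumSubsets n g
sumSubsets-distrib-+ zero    f g = refl
sumSubsets-distrib-+ (suc n) f g =
  trans (cong₂ _+_ (sumSubsets-distrib-+ n (f ∘ (true ∷_)) (g ∘ (true ∷_)))
                   (sumSubsets-distrib-+ n (f ∘ (false ∷_)) (g ∘ (false ∷_))))
        (+-interchange (Σ (f ∘ (true ∷_))) (Σ (g ∘ (true ∷_))) (Σ (f ∘ (false ∷_))) (Σ (g ∘ (false ∷_))))
  where Σ = sumSubsets n

sumSubsets-∷ʳ : ∀ m (f : Subset (suc m) → ℕ) →
  sumSubsets (suc m) f ≡ sumSubsets m (λ t → f (t ∷ʳ true) + f (t ∷ʳ false))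
sumSubsets-∷ʳ zero    f = refl
sumSubsets-∷ʳ (suc m) f =
  cong₂ _+_ (sumSubsets-∷ʳ m (f ∘ (true ∷_))) (sumSubsets-∷ʳ m (f ∘ (false ∷_)))

sumSubsets-rotate : ∀ m (f g : Subset (suc m) → ℕ) → (∀ t b → f (t ∷ʳ b) ≡ g (b ∷ t)) →
  sumSubsets (suc m) f ≡ sumSubsets (suc m) g
sumSubsets-rotate m f g f∷ʳ≡g∷ = begin
  sumSubsets (suc m) f
    ≡⟨ sumSubsets-∷ʳ m f ⟩
  sumSubsets m (λ t → f (t ∷ʳ true) + f (t ∷ʳ false))
    ≡⟨ sumSubsets-cong m (λ t → cong₂ _+_ (f∷ʳ≡g∷ t true) (f∷ʳ≡g∷ t false)) ⟩
  sumSubsets m (λ t → g (true ∷ t) + g (false ∷ t))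
    ≡⟨ sumSubsets-distrib-+ m (g ∘ (true ∷_)) (g ∘ (false ∷_)) ⟩
  sumSubsets (suc m) g ∎

sumSubsets-size : ∀ n ℓ → sumSubsets n (λ s → 𝟙 (∣ s ∣ ≟ ℓ)) ≡ n C ℓ
sumSubsets-size zero    zero    = refl
sumSubsets-size zero    (suc ℓ) = refl
sumSubsets-size (suc n) zero    = cong₂ _+_ (sumSubsets-zero n) (sumSubsets-size n zero)
sumSubsets-size (suc n) (suc ℓ) =
  trans (cong₂ _+_ (sumSubsets-size n ℓ) (sumSubsets-size n (suc ℓ))) (nCk+nC[k+1]≡[n+1]C[k+1] n ℓ)

sumFin-sumSubsets-comm : ∀ n m (f : Fin n → Subset m → ℕ) →
  sumFin n (λ i → sumSubsets m (f i)) ≡ sumSubsets m (λ s → sumFin n (λ i → f i s))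
sumFin-sumSubsets-comm zero    m f = sym (sumSubsets-zero m)
sumFin-sumSubsets-comm (suc n) m f = begin
  sumSubsets m (f zero) + sumFin n (λ i → sumSubsets m (f (suc i)))
    ≡⟨ cong (sumSubsets m (f zero) +_) (sumFin-sumSubsets-comm n m (f ∘ suc)) ⟩
  sumSubsets m (f zero) + sumSubsets m (λ s → sumFin n (λ i → f (suc i) s))
    ≡⟨ sumSubsets-distrib-+ m (f zero) (λ s → sumFin n (λ i → f (suc i) s)) ⟨
  sumSubsets m (λ s → sumFin (suc n) (λ i → f i s)) ∎

sumBy : ∀ {m} → Subset m → (Fin m → ℕ) → ℕ
sumBy []          f = 0
sumBy (true  ∷ s) f = f zero + sumBy s (f ∘ suc)
sumBy (false ∷ s) f = sumBy s (f ∘ suc)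

-- Defs computes elemSum with a where-bound helper that cannot be named here. Abstracting
-- toℕ makes its defining equation a pattern, so unification solves elemSum-go to it.
private
  mutual
    elemSum-go : ∀ {m} → Subset m → (Fin m → ℕ) → ℕ
    elemSum-go = _

    elemSum≡elemSum-go : ∀ {n} (s : Subset n) → elemSum s ≡ elemSum-go s toℕ
    elemSum≡elemSum-go {n} s with (λ (i : Fin n) → toℕ i)
    ... | f = refl

  elemSum-go≡sumBy : ∀ {m} (s : Subset m) f → elemSum-go s f ≡ sumBy s f
  elemSum-go≡sumBy []          f = refl
  elemSum-go≡sumBy (true  ∷ s) f = cong (f zero +_) (elemSum-go≡sumBy s (f ∘ suc))
  elemSum-go≡sumBy (false ∷ s) f = elemSum-go≡sumBy s (f ∘ suc)

elemSum≡sumBy : ∀ {n} (s : Subset n) → elemSum s ≡ sumBy s toℕ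
elemSum≡sumBy s = trans (elemSum≡elemSum-go s) (elemSum-go≡sumBy s toℕ)

sumBy-cong : ∀ {m} (s : Subset m) {f g : Fin m → ℕ} → (∀ i → f i ≡ g i) → sumBy s f ≡ sumBy s g
sumBy-cong []          f≗g = refl
sumBy-cong (true  ∷ s) f≗g = cong₂ _+_ (f≗g zero) (sumBy-cong s (f≗g ∘ suc))
sumBy-cong (false ∷ s) f≗g = sumBy-cong s (f≗g ∘ suc)

sumBy-suc : ∀ {m} (s : Subset m) (f : Fin m → ℕ) → sumBy s (suc ∘ f) ≡ sumBy s f + ∣ s ∣
sumBy-suc []          f = refl
sumBy-suc (true  ∷ s) f = begin
  suc (f zero + sumBy s (suc ∘ f ∘ suc))  ≡⟨ cong (λ x → suc (f zero + x)) (sumBy-suc s (f ∘ suc)) ⟩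
  suc (f zero + (sumBy s (f ∘ suc) + ∣ s ∣)) ≡⟨ cong suc (+-assoc (f zero) _ ∣ s ∣) ⟨
  suc (f zero + sumBy s (f ∘ suc) + ∣ s ∣) ≡⟨ +-suc _ ∣ s ∣ ⟨
  f zero + sumBy s (f ∘ suc) + suc ∣ s ∣ ∎
sumBy-suc (false ∷ s) f = sumBy-suc s (f ∘ suc)

sumBy-∷ʳ : ∀ {m} (s : Subset m) b (f : Fin (suc m) → ℕ) →
  sumBy (s ∷ʳ b) f ≡ sumBy s (f ∘ inject₁) + (if b then f (fromℕ m) else 0)
sumBy-∷ʳ []          true  f = +-identityʳ (f zero)
sumBy-∷ʳ []          false f = refl
sumBy-∷ʳ (true  ∷ s) b     f =
  trans (cong (f zero +_) (sumBy-∷ʳ s b (f ∘ suc))) (sym (+-assoc (f zero) _ _))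
sumBy-∷ʳ (false ∷ s) b     f = sumBy-∷ʳ s b (f ∘ suc)

∣∷ʳ∣≡∣∷∣ : ∀ {m} (t : Subset m) b → ∣ t ∷ʳ b ∣ ≡ ∣ b ∷ t ∣
∣∷ʳ∣≡∣∷∣ []          b     = refl
∣∷ʳ∣≡∣∷∣ (true  ∷ t) true  = cong suc (∣∷ʳ∣≡∣∷∣ t true)
∣∷ʳ∣≡∣∷∣ (true  ∷ t) false = cong suc (∣∷ʳ∣≡∣∷∣ t false)
∣∷ʳ∣≡∣∷∣ (false ∷ t) b     = ∣∷ʳ∣≡∣∷∣ t b

elemSum-∷ : ∀ {m} b (t : Subset m) → elemSum (b ∷ t) ≡ elemSum t + ∣ t ∣
elemSum-∷ b t = begin
  elemSum (b ∷ t)         ≡⟨ elemSum≡sumBy (b ∷ t) ⟩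
  sumBy (b ∷ t) toℕ       ≡⟨ drop-zero b ⟩
  sumBy t (suc ∘ toℕ)     ≡⟨ sumBy-suc t toℕ ⟩
  sumBy t toℕ + ∣ t ∣     ≡⟨ cong (_+ ∣ t ∣) (elemSum≡sumBy t) ⟨
  elemSum t + ∣ t ∣       ∎
  where
  drop-zero : ∀ b → sumBy (b ∷ t) toℕ ≡ sumBy t (suc ∘ toℕ)
  drop-zero true  = refl
  drop-zero false = refl

elemSum-∷ʳ : ∀ {m} (t : Subset m) b → elemSum (t ∷ʳ b) ≡ elemSum t + (if b then m else 0)
elemSum-∷ʳ {m} t b = begin
  elemSum (t ∷ʳ b)                                   ≡⟨ elemSum≡sumBy (t ∷ʳ b) ⟩
  sumBy (t ∷ʳ b) toℕ                                 ≡⟨ sumBy-∷ʳ t b toℕ ⟩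
  sumBy t (toℕ ∘ inject₁) + (if b then toℕ (fromℕ m) else 0)
    ≡⟨ cong₂ _+_ (sumBy-cong t toℕ-inject₁) (cong (λ x → if b then x else 0) (toℕ-fromℕ m)) ⟩
  sumBy t toℕ + (if b then m else 0)                 ≡⟨ cong (_+ _) (elemSum≡sumBy t) ⟨
  elemSum t + (if b then m else 0)                   ∎

-- Translation by 1 in ℤ/(m+1) maps the subset t ∷ʳ b to b ∷ t.
elemSum-rotate : ∀ {m} (t : Subset m) b →
  elemSum (b ∷ t) % suc m ≡ (elemSum (t ∷ʳ b) + ∣ t ∷ʳ b ∣) % suc m
elemSum-rotate {m} t false = cong (_% suc m) (begin
  elemSum (false ∷ t)                        ≡⟨ elemSum-∷ false t ⟩
  elemSum t + ∣ t ∣                          ≡⟨ cong (_+ ∣ t ∣) (+-identityʳ (elemSum t)) ⟨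
  elemSum t + 0 + ∣ t ∣                      ≡⟨ cong₂ _+_ (elemSum-∷ʳ t false) (∣∷ʳ∣≡∣∷∣ t false) ⟨
  elemSum (t ∷ʳ false) + ∣ t ∷ʳ false ∣      ∎)
elemSum-rotate {m} t true = begin
  elemSum (true ∷ t) % suc m                 ≡⟨ [m+n]%n≡m%n (elemSum (true ∷ t)) (suc m) ⟨
  (elemSum (true ∷ t) + suc m) % suc m       ≡⟨ cong (λ x → (x + suc m) % suc m) (elemSum-∷ true t) ⟩
  (elemSum t + ∣ t ∣ + suc m) % suc m        ≡⟨ cong (_% suc m) (shuffle (elemSum t) ∣ t ∣ m) ⟩
  (elemSum t + m + suc ∣ t ∣) % suc m
    ≡⟨ cong₂ (λ x y → (x + y) % suc m) (elemSum-∷ʳ t true) (∣∷ʳ∣≡∣∷∣ t true) ⟨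
  (elemSum (t ∷ʳ true) + ∣ t ∷ʳ true ∣) % suc m ∎
  where
  shuffle : ∀ e c m → e + c + suc m ≡ e + m + suc c
  shuffle = solve 3 (λ e c m → e :+ c :+ (con 1 :+ m) := e :+ m :+ (con 1 :+ c)) refl

%-cong-+ʳ : ∀ {n} x y c → x % suc n ≡ y % suc n → (x + c) % suc n ≡ (y + c) % suc n
%-cong-+ʳ {n} x y c x≡y = begin
  (x + c) % suc n                    ≡⟨ %-distribˡ-+ x c (suc n) ⟩
  (x % suc n + c % suc n) % suc n    ≡⟨ cong (λ z → (z + c % suc n) % suc n) x≡y ⟩
  (y % suc n + c % suc n) % suc n    ≡⟨ %-distribˡ-+ y c (suc n) ⟨
  (y + c) % suc n                    ∎

-- c * n ≡ - c (mod suc n), so adding it undoes adding c.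
%-cancel-+ʳ : ∀ {n} x y c → (x + c) % suc n ≡ (y + c) % suc n → x % suc n ≡ y % suc n
%-cancel-+ʳ {n} x y c x+c≡y+c = begin
  x % suc n                  ≡⟨ [m+kn]%n≡m%n x c (suc n) ⟨
  (x + c * suc n) % suc n    ≡⟨ cong (_% suc n) (regroup x) ⟩
  (x + c + c * n) % suc n    ≡⟨ %-cong-+ʳ (x + c) (y + c) (c * n) x+c≡y+c ⟩
  (y + c + c * n) % suc n    ≡⟨ cong (_% suc n) (regroup y) ⟨
  (y + c * suc n) % suc n    ≡⟨ [m+kn]%n≡m%n y c (suc n) ⟩
  y % suc n                  ∎
  where
  regroup : ∀ z → z + c * suc n ≡ z + c + c * n
  regroup z = solve 3 (λ z c n → z :+ c :* (con 1 :+ n) := z :+ c :+ c :* n) refl z c n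

Period : (ℕ → ℕ) → ℕ → Set
Period f m = ∀ v → f (v + m) ≡ f v

Period-* : ∀ (f : ℕ → ℕ) {m} → Period f m → ∀ k → Period f (k * m)
Period-* f     per zero    v = cong f (+-identityʳ v)
Period-* f {m} per (suc k) v = begin
  f (v + (m + k * m))  ≡⟨ cong f (trans (cong (v +_) (+-comm m (k * m))) (sym (+-assoc v (k * m) m))) ⟩
  f (v + k * m + m)    ≡⟨ per (v + k * m) ⟩
  f (v + k * m)        ≡⟨ Period-* f per k v ⟩
  f v                  ∎

Period-Bézout : ∀ (f : ℕ → ℕ) {m n} → Period f m → Period f n →
  ∀ x y → 1 + y * n ≡ x * m → Period f 1
Period-Bézout f {m} {n} per-m per-n x y 1+yn≡xm v = begin
  f (v + 1)            ≡⟨ Period-* f per-n y (v + 1) ⟨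
  f (v + 1 + y * n)    ≡⟨ cong f (trans (+-assoc v 1 (y * n)) (cong (v +_) 1+yn≡xm)) ⟩
  f (v + x * m)        ≡⟨ Period-* f per-m x v ⟩
  f v                  ∎

Period-1⇒constant : ∀ (f : ℕ → ℕ) → Period f 1 → ∀ v → f v ≡ f 0
Period-1⇒constant f per zero    = refl
Period-1⇒constant f per (suc v) =
  trans (cong f (+-comm 1 v)) (trans (per v) (Period-1⇒constant f per v))

coprime-periods⇒constant : ∀ (f : ℕ → ℕ) {m n} → Coprime m n → Period f m → Period f n →
  ∀ v → f v ≡ f 0
coprime-periods⇒constant f coprime per-m per-n = Period-1⇒constant f per-1
  where
  per-1 : Period f 1
  per-1 with coprime-Bézout coprime
  ... | Bézout.+- x y 1+yn≡xm = Period-Bézout f per-m per-n x y 1+yn≡xm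
  ... | Bézout.-+ x y 1+xm≡yn = Period-Bézout f per-n per-m y x 1+xm≡yn

sizeAndSum? : ∀ n ℓ w (s : Subset (suc n)) → Dec (∣ s ∣ ≡ ℓ × sumModP (suc n) s ≡ w)
sizeAndSum? n ℓ w s = (∣ s ∣ ≟ ℓ) ×-dec (sumModP (suc n) s ≟ w)

Scountℕ : (n ℓ w : ℕ) → ℕ
Scountℕ n ℓ w = sumSubsets (suc n) (𝟙 ∘ sizeAndSum? n ℓ w)

Scountℕ-period-ℓ : ∀ n ℓ → Period (λ v → Scountℕ n ℓ (v % suc n)) ℓ
Scountℕ-period-ℓ n ℓ v = sym (sumSubsets-rotate n (𝟙 ∘ before) (𝟙 ∘ after) λ t b →
  𝟙-cong-⇔ (same-condition t b) (before (t ∷ʳ b)) (after (b ∷ t)))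
  where
  p = suc n
  before : (s : Subset p) → Dec (∣ s ∣ ≡ ℓ × sumModP p s ≡ v % p)
  before = sizeAndSum? n ℓ (v % p)
  after : (s : Subset p) → Dec (∣ s ∣ ≡ ℓ × sumModP p s ≡ (v + ℓ) % p)
  after = sizeAndSum? n ℓ ((v + ℓ) % p)
  shifted : ∀ t b → ∣ t ∷ʳ b ∣ ≡ ℓ → elemSum (b ∷ t) % p ≡ (elemSum (t ∷ʳ b) + ℓ) % p
  shifted t b size = trans (elemSum-rotate t b) (cong (λ k → (elemSum (t ∷ʳ b) + k) % p) size)
  same-condition : ∀ t b →
    (∣ t ∷ʳ b ∣ ≡ ℓ × sumModP p (t ∷ʳ b) ≡ v % p) ⇔ (∣ b ∷ t ∣ ≡ ℓ × sumModP p (b ∷ t) ≡ (v + ℓ) % p)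
  same-condition t b = mk⇔
    (λ (size , sum≡) → trans (sym (∣∷ʳ∣≡∣∷∣ t b)) size ,
                       trans (shifted t b size) (%-cong-+ʳ (elemSum (t ∷ʳ b)) v ℓ sum≡))
    (λ (size , sum≡) → let size′ = trans (∣∷ʳ∣≡∣∷∣ t b) size in
                       size′ , %-cancel-+ʳ (elemSum (t ∷ʳ b)) v ℓ (trans (sym (shifted t b size′)) sum≡))

Scount-constant : ∀ n ℓ → Coprime (suc n) ℓ → ∀ (u w : Fin (suc n)) →
  Scount (suc n) ℓ u ≡ Scount (suc n) ℓ w
Scount-constant n ℓ coprime u w = trans (≡f0 u) (sym (≡f0 w))
  where
  f : ℕ → ℕ
  f v = Scountℕ n ℓ (v % suc n)
  ≡f0 : ∀ u → Scount (suc n) ℓ u ≡ f 0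
  ≡f0 u = begin
    Scount (suc n) ℓ u   ≡⟨ length-filter-allSubsets (suc n) (sizeAndSum? n ℓ (toℕ u)) ⟩
    Scountℕ n ℓ (toℕ u)  ≡⟨ cong (Scountℕ n ℓ) (m<n⇒m%n≡m (toℕ<n u)) ⟨
    f (toℕ u)            ≡⟨ coprime-periods⇒constant f coprime period-p (Scountℕ-period-ℓ n ℓ) (toℕ u) ⟩
    f 0                  ∎
    where
    period-p : Period f (suc n)
    period-p v = cong (Scountℕ n ℓ) ([m+n]%n≡m%n v (suc n))

sumFin-Scount : ∀ n ℓ → sumFin (suc n) (Scount (suc n) ℓ) ≡ suc n C ℓ
sumFin-Scount n ℓ = begin
  sumFin p (Scount p ℓ)
    ≡⟨ sumFin-cong p (λ u → length-filter-allSubsets p (sizeAndSum? n ℓ (toℕ u))) ⟩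
  sumFin p (λ u → Scountℕ n ℓ (toℕ u))
    ≡⟨ sumFin-sumSubsets-comm p p (λ u → 𝟙 ∘ sizeAndSum? n ℓ (toℕ u)) ⟩
  sumSubsets p (λ s → sumFin p (λ u → 𝟙 (sizeAndSum? n ℓ (toℕ u) s)))
    ≡⟨ sumSubsets-cong p (λ s → sumFin-𝟙-×-dec-≡-toℕ (∣ s ∣ ≟ ℓ) (m%n<n (elemSum s) p)) ⟩
  sumSubsets p (λ s → 𝟙 (∣ s ∣ ≟ ℓ))
    ≡⟨ sumSubsets-size p ℓ ⟩
  p C ℓ ∎
  where
  p = suc n

-- An (ℓ+1)-subset containing 0 is true ∷ t, and t read as false ∷ t is an ℓ-subset of F_p^*
-- with the same sum; both facts hold definitionally.
Scount-split : ∀ q ℓ (u : Fin (suc q)) → Scount (suc q) (suc ℓ) u ≡ Sstar q (suc ℓ) u + Sstar q ℓ u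
Scount-split q ℓ u = begin
  Scount (suc q) (suc ℓ) u          ≡⟨ length-filter-allSubsets (suc q) _ ⟩
  S ℓ + S (suc ℓ)                   ≡⟨ +-comm (S ℓ) (S (suc ℓ)) ⟩
  S (suc ℓ) + S ℓ                   ≡⟨ cong₂ _+_ (Sstar≡S (suc ℓ)) (Sstar≡S ℓ) ⟨
  Sstar q (suc ℓ) u + Sstar q ℓ u   ∎
  where
  S : ℕ → ℕ
  S k = sumSubsets q (λ t → 𝟙 ((∣ t ∣ ≟ k) ×-dec (sumModP (suc q) (false ∷ t) ≟ toℕ u)))
  Sstar≡S : ∀ k → Sstar q k u ≡ S k
  Sstar≡S k = trans (length-filter-allSubsets (suc q) _) (cong (_+ S k) (sumSubsets-zero q))

proposition4 : (r : ℕ) → Prime (suc (suc r)) → (ℓ : ℕ) → 1 ≤ ℓ → ℓ < suc (suc r) →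
    (u : Fin (suc (suc r))) →
    (Scount (suc (suc r)) ℓ u * suc (suc r) ≡ suc (suc r) C ℓ)
    × (Scount (suc (suc r)) ℓ u ≡ Sstar (suc r) ℓ (suc zero) + Sstar (suc r) (ℓ ∸ 1) (suc zero))
    × (Scount (suc (suc r)) ℓ u ≡ Sstar (suc r) ℓ zero + Sstar (suc r) (ℓ ∸ 1) zero)
proposition4 r p-prime (suc ℓ) _ ℓ<p u = times-p , split (suc zero) , split zero
  where
  p = suc (suc r)
  constant : ∀ w → Scount p (suc ℓ) u ≡ Scount p (suc ℓ) w
  constant = Scount-constant (suc r) (suc ℓ) (prime⇒coprime p-prime ℓ<p) u
  times-p : Scount p (suc ℓ) u * p ≡ p C suc ℓ
  times-p = begin
    Scount p (suc ℓ) u * p       ≡⟨ *-comm (Scount p (suc ℓ) u) p ⟩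
    p * Scount p (suc ℓ) u       ≡⟨ sumFin-const p (sym ∘ constant) ⟨
    sumFin p (Scount p (suc ℓ))  ≡⟨ sumFin-Scount (suc r) (suc ℓ) ⟩
    p C suc ℓ                    ∎
  split : ∀ w → Scount p (suc ℓ) u ≡ Sstar (suc r) (suc ℓ) w + Sstar (suc r) ℓ w
  split w = trans (constant w) (Scount-split (suc r) ℓ w)
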